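{- For all positive integers $m,n,k$ with $m \leq k$, \[ L(n,m,k) = \sum_{j \geq 1} (-1)^{j-1}F(n+1-jm,k,j). \]
   Context: A composition of $n$ is a finite sequence of positive integers summing to $n$. $L(n,m,k)$ is the number of compositions of $n$ all of whose parts are at most $k$ and at least one of whose parts equals $m$. For $k\ge 1$: $F(n,k)=0$ for $n\le0$, $F(1,k)=1$, $F(n,k)=\sum_{j=1}^kF(n-j,k)$ for $n\ge2$. For $r\ge0$, $F(n+1,k,r)$ is the coefficient of $x^n$ in $\left(\sum_{j\ge0}F(j+1,k)x^j\right)^{r+1}$ for $n\ge0$, and $F(n,k,r)=0$ for $n\le 0$. -}

module Defs where

open import Data.Nat as ℕ using (ℕ; zero; suc; _∸_; _≤?_; _≟_)
open import Data.Integer as ℤ using (ℤ; +_; -[1+_])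
open import Data.List using (List; []; _∷_; map; concatMap; length; filter; upTo; foldr)
open import Data.Nat.ListAction using (sum)
open import Data.List.Relation.Unary.All using (All)
open import Data.List.Relation.Unary.All using (all?) public
open import Data.List.Relation.Unary.Any using (Any; any?)
open import Data.Product using (_×_)
open import Relation.Binary.PropositionalEquality using (_≡_)
open import Relation.Nullary.Decidable using (_×-dec_)

-- [ a .. b ] as the list a, a+1, ..., b  (empty if b < a)
range : ℕ → ℕ → List ℕ
range a b = map (ℕ._+ a) (upTo (suc b ∸ a))

-- compsF f n : all compositions of n (lists of positive integers summing
-- to n), using fuel f (f ≥ n suffices, since every part is ≥ 1).
compsF : ℕ → ℕ → List (List ℕ)
compsF _       zero    = [] ∷ []
compsF zero    (suc n) = []
compsF (suc f) (suc n) =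
  concatMap (λ j → map (j ∷_) (compsF f (suc n ∸ j))) (range 1 (suc n))

compositions : ℕ → List (List ℕ)
compositions n = compsF n n

L : ℕ → ℕ → ℕ → ℕ
L n m k = length (filter (λ c → all? (λ p → p ≤? k) c ×-dec any? (λ p → p ≟ m) c)
                         (compositions n))

-- FF f k n with fuel f (f ≥ n suffices): F(0)=0, F(1)=1,
-- F(n) = Σ_{j=1}^k F(n-j) for n ≥ 2 (with F(i) = 0 for i ≤ 0, realised by
-- truncated subtraction landing on 0).
FF : ℕ → ℕ → ℕ → ℕ
FF _       k zero          = 0
FF _       k (suc zero)    = 1
FF zero    k (suc (suc n)) = 0
FF (suc f) k (suc (suc n)) = sum (map (λ j → FF f k (suc (suc n) ∸ j)) (range 1 k))

F : ℕ → ℕ → ℕ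
F n k = FF n k n

-- coeff k r t = coefficient of x^t in (Σ_{j≥0} F(j+1,k) x^j)^(r+1)
coeff : ℕ → ℕ → ℕ → ℕ
coeff k zero    t = F (suc t) k
coeff k (suc r) t = sum (map (λ i → F (suc i) k ℕ.* coeff k r (t ∸ i)) (range 0 t))

F3 : ℤ → ℕ → ℕ → ℕ
F3 (+ zero)   k r = 0
F3 (+ suc t)  k r = coeff k r t
F3 -[1+ _ ]   k r = 0

sumℤ : List ℤ → ℤ
sumℤ = foldr ℤ._+_ (+ 0)

module Submission where

open import Defs
open import Data.Nat using (ℕ; suc; _≤_; NonZero)
open import Data.Integer using (ℤ; +_; _-_; _*_; -1ℤ; _^_)
open import Data.List using (map)
open import Relation.Binary.PropositionalEquality using (_≡_)

open import Algebra.Properties.CommutativeSemigroup using (interchange)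
open import Data.Empty using (⊥-elim)
open import Data.Integer as ℤ using (_+_; -_)
import Data.Integer.Properties as ℤP
open import Data.List using (List; []; _∷_; _++_; applyUpTo; upTo; concat; filter; length)
import Data.List.Properties as LP
open import Data.List.Relation.Unary.All as All using (All)
open import Data.List.Relation.Unary.Any using (Any; here; there; any?)
open import Data.Nat as ℕ using (zero; _<_; _∸_; s≤s; _≤?_; _≟_)
open import Data.Nat.Induction using (<-rec)
open import Data.Nat.ListAction using (sum)
import Data.Nat.Properties as ℕP
open import Data.Product using (_×_; _,_)
open import Function using (_∘_)
open import Level using (0ℓ)
open import Relation.Binary.PropositionalEquality
  using (_≢_; refl; sym; trans; cong; cong₂; module ≡-Reasoning)
open import Relation.Nullary using (yes; no; ¬_)
open import Relation.Nullary.Decidable using (_×-dec_)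
open import Relation.Unary using (Pred; Decidable)

-- An integer sequence f : ℕ → ℤ is read as the formal
-- power series Σ f(t) xᵗ.  Put P = x + x² + ⋯ + xᵏ and A = Σ F(t+1,k) xᵗ,
-- so that A = 1 + P·A and F(t+1,k,r) = [xᵗ] A^{r+1}.  Splitting a
-- composition by its first part shows that A(t) counts the compositions of
-- t with all parts ≤ k, and that the sequence L(t) = L(t,m,k) satisfies
--     L = P·L + xᵐ·(A − L)
-- (a first part equal to m frees the remaining parts from containing m).
-- The alternating series R = Σ_{j≥0} (-1)ʲ x^{(j+1)m} A^{j+2} satisfies the
-- same recurrence: it telescopes because A^{j+2} = A^{j+1} + P·A^{j+2}.
-- Both recurrences compute the value at t from values at smaller indices,
-- hence L = R, and reindexing j ↦ j+1 gives the theorem.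

∑ : ℕ → (ℕ → ℤ) → ℤ
∑ zero    f = + 0
∑ (suc n) f = f 0 + ∑ n (f ∘ suc)

∑-cong : ∀ n {f g : ℕ → ℤ} → (∀ i → f i ≡ g i) → ∑ n f ≡ ∑ n g
∑-cong zero    e = refl
∑-cong (suc n) e = cong₂ _+_ (e 0) (∑-cong n (e ∘ suc))

∑-zero : ∀ n → ∑ n (λ _ → + 0) ≡ + 0
∑-zero zero    = refl
∑-zero (suc n) = trans (ℤP.+-identityˡ _) (∑-zero n)

∑-+ : ∀ n (f g : ℕ → ℤ) → ∑ n (λ i → f i + g i) ≡ ∑ n f + ∑ n g
∑-+ zero    f g = refl
∑-+ (suc n) f g = trans (cong (_+_ (f 0 + g 0)) (∑-+ n (f ∘ suc) (g ∘ suc)))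
                       (interchange ℤP.+-commutativeSemigroup (f 0) (g 0) _ _)

∑-neg : ∀ n (f : ℕ → ℤ) → ∑ n (λ i → - f i) ≡ - ∑ n f
∑-neg zero    f = refl
∑-neg (suc n) f = trans (cong (_+_ (- f 0)) (∑-neg n (f ∘ suc)))
                        (sym (ℤP.neg-distrib-+ (f 0) _))

∑-*ʳ : ∀ n (f : ℕ → ℤ) c → ∑ n (λ i → f i * c) ≡ ∑ n f * c
∑-*ʳ zero    f c = refl
∑-*ʳ (suc n) f c = trans (cong (_+_ (f 0 * c)) (∑-*ʳ n (f ∘ suc) c))
                         (sym (ℤP.*-distribʳ-+ c (f 0) _))

∑-swap : ∀ a b (f : ℕ → ℕ → ℤ) →
         ∑ a (λ i → ∑ b (λ j → f i j)) ≡ ∑ b (λ j → ∑ a (λ i → f i j))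
∑-swap zero    b f = sym (∑-zero b)
∑-swap (suc a) b f = trans (cong (_+_ (∑ b (f 0))) (∑-swap a b (f ∘ suc)))
                           (sym (∑-+ b (f 0) (λ j → ∑ a (λ i → f (suc i) j))))

∑-split : ∀ a b (f : ℕ → ℤ) → ∑ (a ℕ.+ b) f ≡ ∑ a f + ∑ b (λ i → f (a ℕ.+ i))
∑-split zero    b f = sym (ℤP.+-identityˡ _)
∑-split (suc a) b f = trans (cong (_+_ (f 0)) (∑-split a b (f ∘ suc)))
                            (sym (ℤP.+-assoc (f 0) _ _))

sumℤ-applyUpTo : ∀ (g : ℕ → ℤ) n → sumℤ (applyUpTo g n) ≡ ∑ n g
sumℤ-applyUpTo g zero    = refl
sumℤ-applyUpTo g (suc n) = cong (_+_ (g 0)) (sumℤ-applyUpTo (g ∘ suc) n)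

sumℤ-range : ∀ (h : ℕ → ℤ) a n →
             sumℤ (map h (map (ℕ._+ a) (upTo n))) ≡ ∑ n (λ i → h (i ℕ.+ a))
sumℤ-range h a n = trans (cong sumℤ (trans (sym (LP.map-∘ (upTo n))) (LP.map-upTo _ n)))
                         (sumℤ-applyUpTo _ n)

cast-sum : ∀ (h : ℕ → ℕ) xs → + sum (map h xs) ≡ sumℤ (map (+_ ∘ h) xs)
cast-sum h []       = refl
cast-sum h (x ∷ xs) = trans (ℤP.pos-+ (h x) _) (cong (_+_ (+ h x)) (cast-sum h xs))

sum-range : ∀ (h : ℕ → ℕ) a n →
            + sum (map h (map (ℕ._+ a) (upTo n))) ≡ ∑ n (λ i → + h (i ℕ.+ a))
sum-range h a n = trans (cast-sum h (map (ℕ._+ a) (upTo n))) (sumℤ-range (+_ ∘ h) a n)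

-- Defs writes the index i+1 where the proof uses suc i
∸-+1 : ∀ a i → suc a ∸ (i ℕ.+ 1) ≡ a ∸ i
∸-+1 a i rewrite ℕP.+-comm i 1 = refl

guard : ℕ → ℕ → ℤ → ℤ
guard zero    t       x = x
guard (suc l) zero    x = + 0
guard (suc l) (suc t) x = guard l t x

guard-+ : ∀ l t x y → guard l t (x + y) ≡ guard l t x + guard l t y
guard-+ zero    t       x y = refl
guard-+ (suc l) zero    x y = refl
guard-+ (suc l) (suc t) x y = guard-+ l t x y

guard-neg : ∀ l t x → guard l t (- x) ≡ - guard l t x
guard-neg zero    t       x = refl
guard-neg (suc l) zero    x = refl
guard-neg (suc l) (suc t) x = guard-neg l t x

guard-∑ : ∀ l t n (f : ℕ → ℤ) → guard l t (∑ n f) ≡ ∑ n (λ i → guard l t (f i))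
guard-∑ zero    t       n f = refl
guard-∑ (suc l) zero    n f = sym (∑-zero n)
guard-∑ (suc l) (suc t) n f = guard-∑ l t n f

guard-holds : ∀ l t x → l ≤ t → guard l t x ≡ x
guard-holds zero    t       x _       = refl
guard-holds (suc l) (suc t) x (s≤s p) = guard-holds l t x p

guard-fails : ∀ l t x → t < l → guard l t x ≡ + 0
guard-fails (suc l) zero    x _       = refl
guard-fails (suc l) (suc t) x (s≤s p) = guard-fails l t x p

-- Σ_{l<a} [l < b] f l  is symmetric in a and b (both equal Σ_{l<min a b} f l);
-- this lets a sum over first parts i ≤ n be read as a sum over shifts l < k.
∑-guard-swap : ∀ a b (f : ℕ → ℤ) →
               ∑ a (λ l → guard (suc l) b (f l)) ≡ ∑ b (λ l → guard (suc l) a (f l))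
∑-guard-swap zero    b       f = sym (∑-zero b)
∑-guard-swap (suc a) zero    f = trans (ℤP.+-identityˡ _) (∑-zero a)
∑-guard-swap (suc a) (suc b) f = cong (_+_ (f 0)) (∑-guard-swap a b (f ∘ suc))

pick : ℕ → ℕ → ℤ → ℤ
pick zero    zero    x = x
pick zero    (suc a) x = + 0
pick (suc i) zero    x = + 0
pick (suc i) (suc a) x = pick i a x

pick-same : ∀ i x → pick i i x ≡ x
pick-same zero    x = refl
pick-same (suc i) x = pick-same i x

pick-other : ∀ i a x → i ≢ a → pick i a x ≡ + 0
pick-other zero    zero    x p = ⊥-elim (p refl)
pick-other zero    (suc a) x p = refl
pick-other (suc i) zero    x p = refl
pick-other (suc i) (suc a) x p = pick-other i a x (p ∘ cong suc)

∑-pick : ∀ N a (h : ℕ → ℤ) → ∑ N (λ i → pick i a (h i)) ≡ guard (suc a) N (h a)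
∑-pick zero    a       h = refl
∑-pick (suc N) zero    h = trans (cong (_+_ (h 0)) (∑-zero N)) (ℤP.+-identityʳ _)
∑-pick (suc N) (suc a) h = trans (ℤP.+-identityˡ _) (∑-pick N a (h ∘ suc))

alt : ℕ → ℤ → ℤ
alt zero    x = x
alt (suc j) x = - alt j x

pow-alt : ∀ j x → (-1ℤ ^ j) * x ≡ alt j x
pow-alt zero    x = ℤP.*-identityˡ x
pow-alt (suc j) x = trans (ℤP.*-assoc -1ℤ (-1ℤ ^ j) x)
                          (trans (ℤP.-1*i≡-i _) (cong -_ (pow-alt j x)))

alt-zero : ∀ j → alt j (+ 0) ≡ + 0
alt-zero zero    = refl
alt-zero (suc j) = cong -_ (alt-zero j)

alt-+ : ∀ j x y → alt j (x + y) ≡ alt j x + alt j y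
alt-+ zero    x y = refl
alt-+ (suc j) x y = trans (cong -_ (alt-+ j x y)) (ℤP.neg-distrib-+ (alt j x) (alt j y))

alt-∑ : ∀ j n (f : ℕ → ℤ) → alt j (∑ n f) ≡ ∑ n (λ i → alt j (f i))
alt-∑ zero    n f = refl
alt-∑ (suc j) n f = trans (cong -_ (alt-∑ j n f)) (sym (∑-neg n (λ i → alt j (f i))))

guard-alt : ∀ l t j x → guard l t (alt j x) ≡ alt j (guard l t x)
guard-alt l t zero    x = refl
guard-alt l t (suc j) x = trans (guard-neg l t _) (cong -_ (guard-alt l t j x))

-- a sequence f stands for the formal power series Σ f(t) xᵗ
Seq : Set
Seq = ℕ → ℤ

δ : Seq
δ zero    = + 1
δ (suc _) = + 0

-- multiplication by xˡ
shift : ℕ → Seq → Seq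
shift l f t = guard l t (f (t ∸ l))

conv : Seq → Seq → Seq
conv f g t = ∑ (suc t) (λ i → f i * g (t ∸ i))

Causal : (Seq → Seq) → Set
Causal Φ = ∀ {f g : Seq} t → (∀ s → s < t → f s ≡ g s) → Φ f t ≡ Φ g t

-- xˡ f at t depends only on f at t ∸ l, which lies below t when l ≥ 1
shift-cong : ∀ l {f g : Seq} → (∀ s → f s ≡ g s) → ∀ t → shift l f t ≡ shift l g t
shift-cong l e t = cong (guard l t) (e (t ∸ l))

shift-causal : ∀ l → Causal (shift (suc l))
shift-causal l zero    e = refl
shift-causal l (suc t) e = cong (guard l t) (e (t ∸ l) (s≤s (ℕP.m∸n≤m t l)))

shift-+ : ∀ a b f t → shift (a ℕ.+ b) f t ≡ shift a (shift b f) t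
shift-+ zero    b f t       = refl
shift-+ (suc a) b f zero    = refl
shift-+ (suc a) b f (suc t) = shift-+ a b f t

shift-comm : ∀ a b f t → shift a (shift b f) t ≡ shift b (shift a f) t
shift-comm a b f t = begin
  shift a (shift b f) t   ≡⟨ shift-+ a b f t ⟨
  shift (a ℕ.+ b) f t     ≡⟨ cong (λ c → shift c f t) (ℕP.+-comm a b) ⟩
  shift (b ℕ.+ a) f t     ≡⟨ shift-+ b a f t ⟩
  shift b (shift a f) t   ∎
  where open ≡-Reasoning

conv-cong : ∀ {f₁ f₂} g t → (∀ s → f₁ s ≡ f₂ s) → conv f₁ g t ≡ conv f₂ g t
conv-cong g t e = ∑-cong (suc t) (λ i → cong (_* g (t ∸ i)) (e i))

conv-δ : ∀ g t → conv δ g t ≡ g t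
conv-δ g t = trans (cong (_+_ (+ 1 * g t)) (∑-zero t))
                   (trans (ℤP.+-identityʳ _) (ℤP.*-identityˡ (g t)))

conv-+ : ∀ f₁ f₂ g t → conv (λ s → f₁ s + f₂ s) g t ≡ conv f₁ g t + conv f₂ g t
conv-+ f₁ f₂ g t =
  trans (∑-cong (suc t) (λ i → ℤP.*-distribʳ-+ (g (t ∸ i)) (f₁ i) (f₂ i)))
        (∑-+ (suc t) (λ i → f₁ i * g (t ∸ i)) (λ i → f₂ i * g (t ∸ i)))

conv-shift : ∀ l f g t → conv (shift l f) g t ≡ shift l (conv f g) t
conv-shift zero    f g t       = refl
conv-shift (suc l) f g zero    = refl
conv-shift (suc l) f g (suc t) = trans (ℤP.+-identityˡ _) (conv-shift l f g t)

-- multiplication by P = x + x² + ⋯ + xᵏ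
P : ℕ → Seq → Seq
P k f t = ∑ k (λ l → shift (suc l) f t)

P-causal : ∀ k → Causal (P k)
P-causal k t e = ∑-cong k (λ l → shift-causal l t e)

P-cong : ∀ k {f g : Seq} → (∀ s → f s ≡ g s) → ∀ t → P k f t ≡ P k g t
P-cong k e t = ∑-cong k (λ l → shift-cong (suc l) e t)

conv-P : ∀ k f g t → conv (P k f) g t ≡ P k (conv f g) t
conv-P k f g t = begin
    ∑ (suc t) (λ i → ∑ k (λ l → shift (suc l) f i) * g (t ∸ i))
  ≡⟨ ∑-cong (suc t) (λ i → sym (∑-*ʳ k (λ l → shift (suc l) f i) (g (t ∸ i)))) ⟩
    ∑ (suc t) (λ i → ∑ k (λ l → shift (suc l) f i * g (t ∸ i)))
  ≡⟨ ∑-swap (suc t) k (λ i l → shift (suc l) f i * g (t ∸ i)) ⟩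
    ∑ k (λ l → conv (shift (suc l) f) g t)
  ≡⟨ ∑-cong k (λ l → conv-shift (suc l) f g t) ⟩
    P k (conv f g) t ∎
  where open ≡-Reasoning

shift-P : ∀ k a f t → shift a (P k f) t ≡ P k (shift a f) t
shift-P k a f t = trans (guard-∑ a t k _) (∑-cong k (λ l → shift-comm a (suc l) f t))

causal-unique : ∀ (Φ : Seq → Seq) → Causal Φ → ∀ {f g : Seq} →
                (∀ t → f t ≡ Φ f t) → (∀ t → g t ≡ Φ g t) → ∀ t → f t ≡ g t
causal-unique Φ causal {f} {g} f-rec g-rec = <-rec (λ t → f t ≡ g t) step
  where
    step : ∀ t → (∀ {s} → s < t → f s ≡ g s) → f t ≡ g t
    step t below = trans (f-rec t) (trans (causal t (λ s → below)) (sym (g-rec t)))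

term : ℕ → (ℕ → Seq) → ℕ → Seq
term m C j = shift (suc j ℕ.* m) (C (suc j))

R : ℕ → (ℕ → Seq) → ℕ → Seq
R m C N t = ∑ N (λ j → alt j (term m C j t))

-- If A = 1 + P·A and C_r = A^{r+1}, the full alternating series R∞ (the
-- stable values of the partial sums) is the unique solution of
-- L = P·L + xᵐ(A − L), for any m ≥ 1.
module Inversion (k m' : ℕ) (A : Seq) (A-rec : ∀ t → A t ≡ δ t + P k A t)
                 (C : ℕ → Seq) (C-zero : ∀ t → C 0 t ≡ A t)
                 (C-suc : ∀ r t → C (suc r) t ≡ conv A (C r) t) where

  m : ℕ
  m = suc m'

  C-rec : ∀ r t → C (suc r) t ≡ C r t + P k (C (suc r)) t
  C-rec r t = begin
      C (suc r) t                              ≡⟨ C-suc r t ⟩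
      conv A (C r) t                           ≡⟨ conv-cong (C r) t A-rec ⟩
      conv (λ s → δ s + P k A s) (C r) t       ≡⟨ conv-+ δ (P k A) (C r) t ⟩
      conv δ (C r) t + conv (P k A) (C r) t    ≡⟨ cong₂ _+_ (conv-δ (C r) t) (conv-P k A (C r) t) ⟩
      C r t + P k (conv A (C r)) t             ≡⟨ cong (_+_ (C r t)) (P-cong k (λ s → sym (C-suc r s)) t) ⟩
      C r t + P k (C (suc r)) t                ∎
    where open ≡-Reasoning

  -- multiplying C-rec by x^{(j+1)m}
  term-rec : ∀ j t → term m C j t ≡ shift (suc j ℕ.* m) (C j) t + P k (term m C j) t
  term-rec j t = trans (cong (guard a t) (C-rec j (t ∸ a)))
                       (trans (guard-+ a t _ _) (cong (_+_ (shift a (C j) t)) (shift-P k a (C (suc j)) t)))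
    where a = suc j ℕ.* m

  first-shift : ∀ t → shift (1 ℕ.* m) (C 0) t ≡ shift m A t
  first-shift t = trans (cong (λ a → shift a (C 0) t) (ℕP.*-identityˡ m)) (shift-cong m C-zero t)

  P-R : ∀ N t → ∑ N (λ j → alt j (P k (term m C j) t)) ≡ P k (R m C N) t
  P-R N t = sym (begin
      ∑ k (λ l → guard (suc l) t (∑ N (λ j → alt j (term m C j (t ∸ suc l)))))
    ≡⟨ ∑-cong k (λ l → guard-∑ (suc l) t N _) ⟩
      ∑ k (λ l → ∑ N (λ j → guard (suc l) t (alt j (term m C j (t ∸ suc l)))))
    ≡⟨ ∑-cong k (λ l → ∑-cong N (λ j → guard-alt (suc l) t j _)) ⟩
      ∑ k (λ l → ∑ N (λ j → alt j (shift (suc l) (term m C j) t)))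
    ≡⟨ ∑-swap k N (λ l j → alt j (shift (suc l) (term m C j) t)) ⟩
      ∑ N (λ j → ∑ k (λ l → alt j (shift (suc l) (term m C j) t)))
    ≡⟨ ∑-cong N (λ j → sym (alt-∑ j k (λ l → shift (suc l) (term m C j) t))) ⟩
      ∑ N (λ j → alt j (P k (term m C j) t)) ∎)
    where open ≡-Reasoning

  shift-R : ∀ N t → ∑ N (λ j → alt j (shift m (term m C j) t)) ≡ shift m (R m C N) t
  shift-R N t = sym (trans (guard-∑ m t N _) (∑-cong N (λ j → guard-alt m t j _)))

  R-rec : ∀ N t → R m C (suc N) t ≡ (shift m A t - shift m (R m C N) t) + P k (R m C (suc N)) t
  R-rec N t = begin
      R m C (suc N) t
    ≡⟨ ∑-cong (suc N) (λ j → trans (cong (alt j) (term-rec j t)) (alt-+ j (head j) _)) ⟩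
      ∑ (suc N) (λ j → alt j (head j) + alt j (P k (term m C j) t))
    ≡⟨ ∑-+ (suc N) (λ j → alt j (head j)) (λ j → alt j (P k (term m C j) t)) ⟩
      (head 0 + ∑ N (λ j → - alt j (head (suc j)))) + ∑ (suc N) (λ j → alt j (P k (term m C j) t))
    ≡⟨ cong₂ (λ u v → (head 0 + u) + v) (∑-neg N (λ j → alt j (head (suc j)))) (P-R (suc N) t) ⟩
      (head 0 - ∑ N (λ j → alt j (head (suc j)))) + P k (R m C (suc N)) t
    ≡⟨ cong₂ (λ u v → (u - v) + P k (R m C (suc N)) t) (first-shift t)
             (trans (∑-cong N (λ j → cong (alt j) (shift-+ m (suc j ℕ.* m) (C (suc j)) t)))
                    (shift-R N t)) ⟩
      (shift m A t - shift m (R m C N) t) + P k (R m C (suc N)) t ∎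
    where
      open ≡-Reasoning
      -- x^{(j+1)m} C_j: for j ≥ 1 this is x^m·term (j-1), so consecutive terms cancel
      head : ℕ → ℤ
      head j = shift (suc j ℕ.* m) (C j) t

  -- term j vanishes below index (j+1)m, so R_N t no longer changes once N ≥ t
  term-vanish : ∀ j t → t ≤ j → term m C j t ≡ + 0
  term-vanish j t t≤j = guard-fails (suc j ℕ.* m) t _ (ℕP.≤-trans (s≤s t≤j) (ℕP.m≤m*n (suc j) m))

  R-stable : ∀ N t → t ≤ N → R m C N t ≡ R m C t t
  R-stable N t t≤N = begin
      R m C N t
    ≡⟨ cong (λ M → R m C M t) (sym (ℕP.m+[n∸m]≡n t≤N)) ⟩
      R m C (t ℕ.+ d) t
    ≡⟨ ∑-split t d _ ⟩
      R m C t t + ∑ d (λ i → alt (t ℕ.+ i) (term m C (t ℕ.+ i) t))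
    ≡⟨ cong (_+_ (R m C t t)) (trans (∑-cong d vanish) (∑-zero d)) ⟩
      R m C t t + + 0
    ≡⟨ ℤP.+-identityʳ _ ⟩
      R m C t t ∎
    where
      open ≡-Reasoning
      d : ℕ
      d = N ∸ t
      vanish : ∀ i → alt (t ℕ.+ i) (term m C (t ℕ.+ i) t) ≡ + 0
      vanish i = trans (cong (alt (t ℕ.+ i)) (term-vanish (t ℕ.+ i) t (ℕP.m≤m+n t i)))
                       (alt-zero (t ℕ.+ i))

  R∞ : Seq
  R∞ t = R m C t t

  R∞-rec : ∀ t → R∞ t ≡ P k R∞ t + (shift m A t - shift m R∞ t)
  R∞-rec t = begin
      R∞ t
    ≡⟨ sym (R-stable (suc t) t (ℕP.n≤1+n t)) ⟩
      R m C (suc t) t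
    ≡⟨ R-rec t t ⟩
      (shift m A t - shift m (R m C t) t) + P k (R m C (suc t)) t
    ≡⟨ cong₂ (λ u v → (shift m A t - u) + v)
             (shift-causal m' t (λ s s<t → R-stable t s (ℕP.<⇒≤ s<t)))
             (P-causal k t (λ s s<t → R-stable (suc t) s (ℕP.m≤n⇒m≤1+n (ℕP.<⇒≤ s<t)))) ⟩
      (shift m A t - shift m R∞ t) + P k R∞ t
    ≡⟨ ℤP.+-comm (shift m A t - shift m R∞ t) (P k R∞ t) ⟩
      P k R∞ t + (shift m A t - shift m R∞ t) ∎
    where open ≡-Reasoning

  inversion : ∀ (L : Seq) → (∀ t → L t ≡ P k L t + (shift m A t - shift m L t)) →
              ∀ t → L t ≡ R∞ t
  inversion L L-rec = causal-unique Φ Φ-causal L-rec R∞-rec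
    where
      Φ : Seq → Seq
      Φ f t = P k f t + (shift m A t - shift m f t)
      Φ-causal : Causal Φ
      Φ-causal t e = cong₂ (λ u v → u + (shift m A t - v)) (P-causal k t e) (shift-causal m' t e)

-- the k-bonacci series A = Σ F(t+1,k) xᵗ and its powers C_r = A^{r+1}
module KBonacci (k : ℕ) where

  FF-fuel : ∀ f g n → n ≤ suc f → n ≤ suc g → FF f k n ≡ FF g k n
  FF-fuel f       g       zero          _       _       = refl
  FF-fuel f       g       (suc zero)    _       _       = refl
  FF-fuel (suc f) (suc g) (suc (suc n)) (s≤s p) (s≤s q) =
    cong sum (trans (sym (LP.map-∘ (upTo k)))
                    (trans (LP.map-cong (λ i → FF-fuel f g _ (bound p i) (bound q i)) (upTo k))
                           (LP.map-∘ (upTo k))))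
    where
      bound : ∀ {f} → suc n ≤ suc f → ∀ i → suc (suc n) ∸ (i ℕ.+ 1) ≤ suc f
      bound p i rewrite ∸-+1 (suc n) i = ℕP.≤-trans (ℕP.m∸n≤m (suc n) i) p

  A : Seq
  A t = + F (suc t) k

  A-rec : ∀ t → A t ≡ δ t + P k A t
  A-rec zero    = sym (cong (_+_ (+ 1)) (∑-zero k))
  A-rec (suc n) = trans (sum-range (λ j → FF (suc n) k (suc (suc n) ∸ j)) 1 k)
                        (trans (∑-cong k summand) (sym (ℤP.+-identityˡ _)))
    where
      summand : ∀ i → + FF (suc n) k (suc (suc n) ∸ (i ℕ.+ 1)) ≡ shift (suc i) A (suc n)
      summand i rewrite ∸-+1 (suc n) i with i ℕP.≤? n
      ... | yes i≤n rewrite ℕP.+-∸-assoc 1 i≤n =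
        trans (cong +_ (FF-fuel (suc n) (suc (n ∸ i)) (suc (n ∸ i))
                                (s≤s (ℕP.≤-trans (ℕP.m∸n≤m n i) (ℕP.n≤1+n n))) (ℕP.n≤1+n _)))
              (sym (guard-holds i n _ i≤n))
      ... | no i≰n rewrite ℕP.m≤n⇒m∸n≡0 (ℕP.≰⇒> i≰n) = sym (guard-fails i n _ (ℕP.≰⇒> i≰n))

  C : ℕ → Seq
  C r t = + coeff k r t

  C-suc : ∀ r t → C (suc r) t ≡ conv A (C r) t
  C-suc r t = trans (sum-range (λ i → F (suc i) k ℕ.* coeff k r (t ∸ i)) 0 (suc t))
                    (∑-cong (suc t) product)
    where
      product : ∀ i → + (F (suc (i ℕ.+ 0)) k ℕ.* coeff k r (t ∸ (i ℕ.+ 0))) ≡ A i * C r (t ∸ i)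
      product i rewrite ℕP.+-identityʳ i = ℤP.pos-* (F (suc i) k) (coeff k r (t ∸ i))

  F3-shift : ∀ r a n → + F3 (+ (suc n) - + a) k r ≡ shift a (C r) n
  F3-shift r a n = trans (cong (λ z → + F3 z k r) (ℤP.m-n≡m⊖n (suc n) a)) (shifted a n)
    where
      nonpositive : ∀ a → F3 (0 ℤ.⊖ a) k r ≡ 0
      nonpositive zero    = refl
      nonpositive (suc a) = refl
      shifted : ∀ a n → + F3 (suc n ℤ.⊖ a) k r ≡ shift a (C r) n
      shifted zero    n       = refl
      shifted (suc a) zero    =
        cong +_ (trans (cong (λ z → F3 z k r) (ℤP.[1+m]⊖[1+n]≡m⊖n 0 a)) (nonpositive a))
      shifted (suc a) (suc n) =
        trans (cong (λ z → + F3 z k r) (ℤP.[1+m]⊖[1+n]≡m⊖n (suc n) a)) (shifted a n)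

  alternating-sum : ∀ m n →
    sumℤ (map (λ j → (-1ℤ ^ (j ∸ 1)) * + F3 (+ (suc n) - + (j ℕ.* m)) k j) (range 1 n)) ≡ R m C n n
  alternating-sum m n = trans (sumℤ-range _ 1 n) (∑-cong n summand)
    where
      summand : ∀ i → (-1ℤ ^ (i ℕ.+ 1 ∸ 1)) * + F3 (+ (suc n) - + ((i ℕ.+ 1) ℕ.* m)) k (i ℕ.+ 1)
                      ≡ alt i (term m C i n)
      summand i rewrite ℕP.+-comm i 1 =
        trans (pow-alt i _) (cong (alt i) (F3-shift (suc i) (suc i ℕ.* m) n))

count : {P : Pred (List ℕ) 0ℓ} → Decidable P → List (List ℕ) → ℤ
count P? cs = + length (filter P? cs)

count-concat : ∀ {P : Pred (List ℕ) 0ℓ} (P? : Decidable P) (h : ℕ → List (List ℕ)) (g : ℕ → ℕ) N →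
               count P? (concat (map h (applyUpTo g N))) ≡ ∑ N (λ i → count P? (h (g i)))
count-concat P? h g zero    = refl
count-concat P? h g (suc N) = begin
    + length (filter P? (h (g 0) ++ rest))
  ≡⟨ cong (+_ ∘ length) (LP.filter-++ P? (h (g 0)) rest) ⟩
    + length (filter P? (h (g 0)) ++ filter P? rest)
  ≡⟨ cong +_ (LP.length-++ (filter P? (h (g 0)))) ⟩
    + (length (filter P? (h (g 0))) ℕ.+ length (filter P? rest))
  ≡⟨ ℤP.pos-+ (length (filter P? (h (g 0)))) (length (filter P? rest)) ⟩
    count P? (h (g 0)) + count P? rest
  ≡⟨ cong (_+_ (count P? (h (g 0)))) (count-concat P? h (g ∘ suc) N) ⟩
    ∑ (suc N) (λ i → count P? (h (g i))) ∎
  where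
    open ≡-Reasoning
    rest : List (List ℕ)
    rest = concat (map h (applyUpTo (g ∘ suc) N))

compsF-fuel : ∀ f g a → a ≤ f → a ≤ g → compsF f a ≡ compsF g a
compsF-fuel f       g       zero    _       _       = refl
compsF-fuel (suc f) (suc g) (suc a) (s≤s p) (s≤s q) =
  cong concat (trans (sym (LP.map-∘ (upTo (suc a))))
    (trans (LP.map-cong (λ i → cong (map ((i ℕ.+ 1) ∷_)) (compsF-fuel f g _ (bound p i) (bound q i)))
                        (upTo (suc a)))
           (LP.map-∘ (upTo (suc a)))))
  where
    bound : ∀ {f} → a ≤ f → ∀ i → suc a ∸ (i ℕ.+ 1) ≤ f
    bound p i rewrite ∸-+1 a i = ℕP.≤-trans (ℕP.m∸n≤m a i) p

compositions-suc : ∀ n → compositions (suc n) ≡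
                   concat (map (λ i → map (suc i ∷_) (compositions (n ∸ i))) (upTo (suc n)))
compositions-suc n = cong concat (trans (sym (LP.map-∘ (upTo (suc n)))) (LP.map-cong tail (upTo (suc n))))
  where
    tail : ∀ i → map ((i ℕ.+ 1) ∷_) (compsF n (suc n ∸ (i ℕ.+ 1))) ≡ map (suc i ∷_) (compositions (n ∸ i))
    tail i rewrite ℕP.+-comm i 1 =
      cong (map (suc i ∷_)) (compsF-fuel n (n ∸ i) (n ∸ i) (ℕP.m∸n≤m n i) ℕP.≤-refl)

count-suc : ∀ {P : Pred (List ℕ) 0ℓ} (P? : Decidable P) n →
            count P? (compositions (suc n)) ≡ ∑ (suc n) (λ i → count P? (map (suc i ∷_) (compositions (n ∸ i))))
count-suc P? n = trans (cong (count P?) (compositions-suc n)) (count-concat P? (λ i → map (suc i ∷_) (compositions (n ∸ i))) (λ i → i) (suc n))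

count-cons : ∀ {P Q : Pred (List ℕ) 0ℓ} (P? : Decidable P) (Q? : Decidable Q) x →
             (∀ c → P (x ∷ c) → Q c) → (∀ c → Q c → P (x ∷ c)) →
             ∀ cs → count P? (map (x ∷_) cs) ≡ count Q? cs
count-cons P? Q? x to from cs = cong +_ (lengths cs)
  where
    lengths : ∀ cs → length (filter P? (map (x ∷_) cs)) ≡ length (filter Q? cs)
    lengths []       = refl
    lengths (c ∷ cs) with Q? c
    ... | yes q = trans (cong length (LP.filter-accept P? (from c q))) (cong suc (lengths cs))
    ... | no ¬q = trans (cong length (LP.filter-reject P? (¬q ∘ to c))) (lengths cs)

count-cons-none : ∀ {P : Pred (List ℕ) 0ℓ} (P? : Decidable P) x →
                  (∀ c → ¬ P (x ∷ c)) → ∀ cs → count P? (map (x ∷_) cs) ≡ + 0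
count-cons-none P? x never cs = cong +_ (lengths cs)
  where
    lengths : ∀ cs → length (filter P? (map (x ∷_) cs)) ≡ 0
    lengths []       = refl
    lengths (c ∷ cs) = trans (cong length (LP.filter-reject P? (never c))) (lengths cs)

plus-minus : ∀ a b → a + (b - a) ≡ b
plus-minus a b = begin
  a + (b - a)     ≡⟨ cong (_+_ a) (ℤP.+-comm b (- a)) ⟩
  a + (- a + b)   ≡⟨ ℤP.+-assoc a (- a) b ⟨
  (a - a) + b     ≡⟨ cong (_+ b) (ℤP.+-inverseʳ a) ⟩
  + 0 + b         ≡⟨ ℤP.+-identityˡ b ⟩
  b               ∎
  where open ≡-Reasoning

module CompositionCounts (k m' : ℕ) (m≤k : suc m' ≤ k) where

  m : ℕ
  m = suc m'

  bounded? : Decidable (All (_≤ k))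
  bounded? c = all? (λ p → p ≤? k) c

  hits? : Decidable (λ c → All (_≤ k) c × Any (_≡ m) c)
  hits? c = bounded? c ×-dec any? (λ p → p ≟ m) c

  B : Seq
  B t = count bounded? (compositions t)

  L' : Seq
  L' t = + L t m k

  B-first : ∀ i cs → count bounded? (map (suc i ∷_) cs) ≡ guard (suc i) k (count bounded? cs)
  B-first i cs with suc i ≤? k
  ... | yes i<k = trans (count-cons bounded? bounded? (suc i) (λ { c (_ All.∷ b) → b }) (λ c b → i<k All.∷ b) cs)
                        (sym (guard-holds (suc i) k _ i<k))
  ... | no  i≮k = trans (count-cons-none bounded? (suc i) (λ { c (i<k All.∷ _) → i≮k i<k }) cs)
                        (sym (guard-fails (suc i) k _ (ℕP.≰⇒> i≮k)))

  -- a first part m makes every bounded rest admissible; another part leaves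
  -- the requirement of hitting m to the rest
  L-first : ∀ i cs → count hits? (map (suc i ∷_) cs) ≡
            guard (suc i) k (count hits? cs) + pick i m' (count bounded? cs - count hits? cs)
  L-first i cs with suc i ≤? k | i ≟ m'
  ... | no i≮k | _ =
    trans (count-cons-none hits? (suc i) (λ { c (i<k All.∷ _ , _) → i≮k i<k }) cs)
          (sym (cong₂ _+_ (guard-fails (suc i) k _ (ℕP.≰⇒> i≮k))
                          (pick-other i m' _ (λ { refl → i≮k m≤k }))))
  ... | yes i<k | yes refl =
    trans (count-cons hits? bounded? m (λ { c (_ All.∷ b , _) → b }) (λ c b → (i<k All.∷ b) , here refl) cs)
          (sym (trans (cong₂ _+_ (guard-holds m k _ i<k) (pick-same m' _))
                      (plus-minus (count hits? cs) (count bounded? cs))))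
  ... | yes i<k | no i≢m' =
    trans (count-cons hits? hits? (suc i) rest-hits (λ { c (b , h) → (i<k All.∷ b) , there h }) cs)
          (sym (trans (cong₂ _+_ (guard-holds (suc i) k _ i<k) (pick-other i m' _ i≢m'))
                      (ℤP.+-identityʳ _)))
    where
      rest-hits : ∀ c → All (_≤ k) (suc i ∷ c) × Any (_≡ m) (suc i ∷ c) → All (_≤ k) c × Any (_≡ m) c
      rest-hits c (_ All.∷ b , here i+1≡m) = ⊥-elim (i≢m' (ℕP.suc-injective i+1≡m))
      rest-hits c (_ All.∷ b , there h)    = b , h

  B-rec : ∀ t → B t ≡ δ t + P k B t
  B-rec zero    = sym (cong (_+_ (+ 1)) (∑-zero k))
  B-rec (suc n) = begin
      B (suc n)
    ≡⟨ count-suc bounded? n ⟩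
      ∑ (suc n) (λ i → count bounded? (map (suc i ∷_) (compositions (n ∸ i))))
    ≡⟨ ∑-cong (suc n) (λ i → B-first i (compositions (n ∸ i))) ⟩
      ∑ (suc n) (λ i → guard (suc i) k (B (n ∸ i)))
    ≡⟨ ∑-guard-swap (suc n) k (λ i → B (n ∸ i)) ⟩
      P k B (suc n)
    ≡⟨ ℤP.+-identityˡ _ ⟨
      δ (suc n) + P k B (suc n) ∎
    where open ≡-Reasoning

  B≡A : ∀ t → B t ≡ KBonacci.A k t
  B≡A = causal-unique (λ f t → δ t + P k f t) (λ t e → cong (_+_ (δ t)) (P-causal k t e))
                      B-rec (KBonacci.A-rec k)

  L-rec : ∀ t → L' t ≡ P k L' t + (shift m (KBonacci.A k) t - shift m L' t)
  L-rec zero    = sym (cong (_+ (+ 0 - + 0)) (∑-zero k))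
  L-rec (suc n) = begin
      L' (suc n)
    ≡⟨ count-suc hits? n ⟩
      ∑ (suc n) (λ i → count hits? (map (suc i ∷_) (compositions (n ∸ i))))
    ≡⟨ ∑-cong (suc n) (λ i → L-first i (compositions (n ∸ i))) ⟩
      ∑ (suc n) (λ i → guard (suc i) k (L' (n ∸ i)) + pick i m' (difference i))
    ≡⟨ ∑-+ (suc n) (λ i → guard (suc i) k (L' (n ∸ i))) (λ i → pick i m' (difference i)) ⟩
      ∑ (suc n) (λ i → guard (suc i) k (L' (n ∸ i))) + ∑ (suc n) (λ i → pick i m' (difference i))
    ≡⟨ cong₂ _+_ (∑-guard-swap (suc n) k (λ i → L' (n ∸ i))) (∑-pick (suc n) m' difference) ⟩
      P k L' (suc n) + guard m' n (B (n ∸ m') - L' (n ∸ m'))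
    ≡⟨ cong (_+_ (P k L' (suc n))) (trans (guard-+ m' n _ _) (cong (_+_ (guard m' n (B (n ∸ m')))) (guard-neg m' n (L' (n ∸ m'))))) ⟩
      P k L' (suc n) + (shift m B (suc n) - shift m L' (suc n))
    ≡⟨ cong (λ b → P k L' (suc n) + (b - shift m L' (suc n))) (shift-cong m B≡A (suc n)) ⟩
      P k L' (suc n) + (shift m (KBonacci.A k) (suc n) - shift m L' (suc n)) ∎
    where
      open ≡-Reasoning
      difference : ℕ → ℤ
      difference i = B (n ∸ i) - L' (n ∸ i)

-- L(·,m,k) solves the recurrence characterising R∞, whose value at n is the
-- alternating sum on the right.
mainTheorem7 : (m n k : ℕ) → 1 ≤ m → 1 ≤ n → 1 ≤ k → m ≤ k →
    + L n m k ≡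
      sumℤ (map (λ j → (-1ℤ ^ (j Data.Nat.∸ 1)) * + F3 (+ (suc n) - + (j Data.Nat.* m)) k j)
               (range 1 n))
mainTheorem7 (suc m') n k _ _ _ m≤k =
  trans (inversion L' L-rec n) (sym (alternating-sum (suc m') n))
  where
    open KBonacci k using (A; A-rec; C; C-suc; alternating-sum)
    open CompositionCounts k m' m≤k using (L'; L-rec)
    open Inversion k m' A A-rec C (λ _ → refl) C-suc using (inversion)
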